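{- Every border of a 2D palindrome is a 2D palindrome.
   Context: A 2D word of size $(m,n)$ over a finite alphabet is an $m\times n$ array $w=[w_{i,j}]$. Its reverse is $w^R=[w_{m-i+1,\,n-j+1}]_{i,j}$ and $w$ is a 2D palindrome if $w=w^R$. A prefix of $w$ is a top-left sub-array $[w_{i,j}]_{1\le i\le a,\,1\le j\le b}$, and a suffix of $w$ is a bottom-right sub-array $[w_{i,j}]_{m-a+1\le i\le m,\,n-b+1\le j\le n}$. A border of $w$ is a non-empty 2D word that is both a prefix and a suffix of $w$. -}

module Defs where

open import Data.Nat using (ℕ; _+_; _∸_; _≤_; _<_; s≤s)
open import Data.Nat.Properties using (+-monoʳ-<; m∸n+n≡m)
open import Data.Fin using (Fin; toℕ; fromℕ<; inject≤; opposite)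
open import Data.Fin.Properties using (toℕ<n)
open import Relation.Binary.PropositionalEquality using (_≡_; subst)

Word2 : Set → ℕ → ℕ → Set
Word2 A m n = Fin m → Fin n → A

_≋_ : {A : Set} {m n : ℕ} → Word2 A m n → Word2 A m n → Set
w ≋ v = ∀ i j → w i j ≡ v i j

-- Reverse: (w^R)_{i,j} = w_{m-i+1, n-j+1}  (0-indexed: w_{m-1-i, n-1-j}).
reverse2 : {A : Set} {m n : ℕ} → Word2 A m n → Word2 A m n
reverse2 w i j = w (opposite i) (opposite j)

IsPalindrome2 : {A : Set} {m n : ℕ} → Word2 A m n → Set
IsPalindrome2 w = w ≋ reverse2 w

-- Index shift  i ↦ (m ∸ a) + i  from Fin a into Fin m, given a ≤ m.
shift : {a m : ℕ} → a ≤ m → Fin a → Fin m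
shift {a} {m} a≤m i =
  fromℕ< (subst (λ k → (m ∸ a) + toℕ i < k) (m∸n+n≡m a≤m) (+-monoʳ-< (m ∸ a) (toℕ<n i)))

prefix2 : {A : Set} {m n a b : ℕ} → a ≤ m → b ≤ n → Word2 A m n → Word2 A a b
prefix2 a≤m b≤n w i j = w (inject≤ i a≤m) (inject≤ j b≤n)

suffix2 : {A : Set} {m n a b : ℕ} → a ≤ m → b ≤ n → Word2 A m n → Word2 A a b
suffix2 a≤m b≤n w i j = w (shift a≤m i) (shift b≤n j)

record IsBorder2 {A : Set} {m n a b : ℕ} (u : Word2 A a b) (w : Word2 A m n) : Set where
  field
    nonempty-rows : 1 ≤ a
    nonempty-cols : 1 ≤ b
    a≤m : a ≤ m
    b≤n : b ≤ n
    isPrefix : u ≋ prefix2 a≤m b≤n w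
    isSuffix : u ≋ suffix2 a≤m b≤n w

-- Reversal maps the (a , b)-prefix of w onto the (a , b)-suffix of w^R, so for a
-- border u of a palindrome w:  u = suffix w = suffix w^R = (prefix w)^R = u^R.
module Submission where

open import Data.Nat using (ℕ; _+_; _∸_; _≤_; suc)
open import Data.Nat.Properties using (m∸n+n≡m; +-suc; [m+n]∸[m+o]≡n∸o)
open import Data.Fin using (Fin; toℕ; inject≤; opposite)
open import Data.Fin.Properties using (toℕ-injective; toℕ-inject≤; toℕ-fromℕ<; opposite-prop)
open import Relation.Binary.PropositionalEquality
open import Defs

opposite-shift : ∀ {a m} (a≤m : a ≤ m) (i : Fin a) →
                 opposite (shift a≤m i) ≡ inject≤ (opposite i) a≤m
opposite-shift {a} {m} a≤m i = toℕ-injective (begin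
  toℕ (opposite (shift a≤m i))           ≡⟨ opposite-prop (shift a≤m i) ⟩
  m ∸ suc (toℕ (shift a≤m i))            ≡⟨ cong (λ k → m ∸ suc k) (toℕ-fromℕ< _) ⟩
  m ∸ suc (d + toℕ i)                    ≡⟨ cong₂ _∸_ (sym (m∸n+n≡m a≤m)) (sym (+-suc d (toℕ i))) ⟩
  (d + a) ∸ (d + suc (toℕ i))            ≡⟨ [m+n]∸[m+o]≡n∸o d a (suc (toℕ i)) ⟩
  a ∸ suc (toℕ i)                        ≡⟨ sym (opposite-prop i) ⟩
  toℕ (opposite i)                       ≡⟨ sym (toℕ-inject≤ (opposite i) a≤m) ⟩
  toℕ (inject≤ (opposite i) a≤m)         ∎)
  where
  open ≡-Reasoning
  d : ℕ
  d = m ∸ a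

reverse2-prefix2 : {A : Set} {m n a b : ℕ} (a≤m : a ≤ m) (b≤n : b ≤ n) (w : Word2 A m n) →
                   reverse2 (prefix2 a≤m b≤n w) ≋ suffix2 a≤m b≤n (reverse2 w)
reverse2-prefix2 a≤m b≤n w i j =
  sym (cong₂ w (opposite-shift a≤m i) (opposite-shift b≤n j))

proposition3p6 : {A : Set} {m n a b : ℕ} (w : Word2 A m n) (u : Word2 A a b) →
    IsPalindrome2 w → IsBorder2 u w → IsPalindrome2 u
proposition3p6 w u w-pal u-border i j = begin
  u i j                             ≡⟨ isSuffix i j ⟩
  suffix2 a≤m b≤n w i j             ≡⟨ w-pal _ _ ⟩
  suffix2 a≤m b≤n (reverse2 w) i j  ≡⟨ sym (reverse2-prefix2 a≤m b≤n w i j) ⟩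
  reverse2 (prefix2 a≤m b≤n w) i j  ≡⟨ sym (isPrefix (opposite i) (opposite j)) ⟩
  reverse2 u i j                    ∎
  where
  open ≡-Reasoning
  open IsBorder2 u-border
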